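{- Let $m \in \mathbb{N}$ with $m \geq 1$. Then the structure $M_{2}$ satisfies every instance of quantifier-free $m$-step induction over $\mathcal{L}_1$: for every quantifier-free formula $\varphi(X,\vec z)$ of $\mathcal{L}_1$, $M_2 \models \forall \vec z\, I^{m}_{X}\varphi$.
   Context: Sequences: for a set $\mathcal X$ and ordinal $\alpha$, $\mathcal X^\alpha$ is the set of functions $\alpha\to\mathcal X$; $\mathbb N^* = \bigcup_{n<\omega}\mathbb N^n$; $\varepsilon$ is the empty sequence and $(n)$ the one-element sequence. For $a\in\mathcal X^\alpha$, $b\in\mathcal X^\beta$, the concatenation $a\frown b\in\mathcal X^{\alpha+\beta}$ is given by $(a\frown b)_\gamma = a_\gamma$ if $\gamma<\alpha$ and $=b_\delta$ otherwise, where $\alpha+\delta=\gamma$. For $\alpha>0$ and $\mathfrak a\in(\mathcal X^\alpha)^\beta$, $\lfloor\mathfrak a\rfloor\in\mathcal X^{\alpha\cdot\beta}$ is given by $\lfloor\mathfrak a\rfloor_\xi = (\mathfrak a_\delta)_\mu$ where $\xi=\alpha\cdot\delta+\mu$ with $\mu<\alpha$ (the concatenation of the $\beta$ sequences in order). For $k\in\mathbb N$, $N_k$ is the sequence $(i)_{k\le i<\omega}$ of length $\omega$, and $\mathcal N = \{w\frown N_k : w\in\mathbb N^*, k\in\mathbb N\}$. The structure $M_2$ for the language $\mathcal{L}_1$ (sorts $\mathsf i$, $\mathsf{list}$; symbols $\mathit{nil}:\mathsf{list}$, $\mathit{cons}:\mathsf i\times\mathsf{list}\to\mathsf{list}$,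 infix $\frown:\mathsf{list}\times\mathsf{list}\to\mathsf{list}$) interprets $\mathsf i$ as $\mathbb N$, $\mathsf{list}$ as $\mathfrak L = \{\lfloor\mathfrak l\rfloor\frown w : w\in\mathbb N^*, \mathfrak l\in\mathcal N^\beta, \beta<\omega^2\}$, $\mathit{nil}$ as $\varepsilon$, $\mathit{cons}(n,l)$ as $(n)\frown l$, and $\frown$ as concatenation of sequences. For $\mathsf{i}$-terms $t_1,\dots,t_n$ and a $\mathsf{list}$-term $T$, $\mathit{cons}(t_1,\dots,t_n;T)$ abbreviates $\mathit{cons}(t_1,\mathit{cons}(t_2,\dots,\mathit{cons}(t_n,T)\dots))$. The $m$-step induction axiom $I^{m}_{X}\varphi$ for $\varphi(X,\vec z)$ is \[ \Big(\bigwedge_{i=1}^{m} \forall x_1\dots\forall x_{i-1}\, \varphi(\mathit{cons}(x_1,\dots,x_{i-1};\mathit{nil}),\vec z) \wedge \forall X\,\forall x_1\dots\forall x_m\,\big(\varphi(X,\vec z)\rightarrow \varphi(\mathit{cons}(x_1,\dots,x_m;X),\vec z)\big)\Big) \rightarrow \forall X\,\varphi(X,\vec z). \] -}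

module Defs where

open import Data.Nat using (ℕ; zero; suc; _+_; _∸_; _<_; _<ᵇ_; _≡ᵇ_)
open import Data.Bool using (Bool; true; false; if_then_else_; _∨_; _∧_)
open import Data.List using (List; []; _∷_)
open import Data.Product using (Σ; _×_; _,_)
open import Data.Sum using (_⊎_)
open import Data.Empty using (⊥)
open import Relation.Nullary using (¬_)
open import Relation.Binary.PropositionalEquality using (_≡_)
open import Data.Bool using (T)

-- Ordinals below ω³, in Cantor normal form  ω²·p + ω·q + r  ↦  ⟨ p , q , r ⟩.
-- (Cantor normal form is unique, so ordinal equality is equality of triples.)

record Ord3 : Set where
  constructor ⟨_,_,_⟩
  field
    p q r : ℕ
open Ord3 public

ltᴼ : Ord3 → Ord3 → Bool
ltᴼ ⟨ p , q , r ⟩ ⟨ p' , q' , r' ⟩ =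
  (p <ᵇ p') ∨ ((p ≡ᵇ p') ∧ ((q <ᵇ q') ∨ ((q ≡ᵇ q') ∧ (r <ᵇ r'))))

_<ᴼ_ : Ord3 → Ord3 → Set
α <ᴼ β = T (ltᴼ α β)

_+ᴼ_ : Ord3 → Ord3 → Ord3
⟨ p , q , r ⟩ +ᴼ ⟨ zero , zero , r' ⟩ = ⟨ p , q , r + r' ⟩
⟨ p , q , r ⟩ +ᴼ ⟨ zero , suc q' , r' ⟩ = ⟨ p , q + suc q' , r' ⟩
⟨ p , q , r ⟩ +ᴼ ⟨ suc p' , q' , r' ⟩ = ⟨ p + suc p' , q' , r' ⟩

-- left subtraction: for α ≤ γ, γ ∸ᴼ α is the unique δ with α + δ = γ
_∸ᴼ_ : Ord3 → Ord3 → Ord3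
⟨ p' , q' , r' ⟩ ∸ᴼ ⟨ p , q , r ⟩ =
  if p ≡ᵇ p'
  then (if q ≡ᵇ q' then ⟨ 0 , 0 , r' ∸ r ⟩ else ⟨ 0 , q' ∸ q , r' ⟩)
  else ⟨ p' ∸ p , q' , r' ⟩

-- Sequences of natural numbers of ordinal length < ω³.
-- The values of 'val' at indices ≥ len are irrelevant (see _≈_).

record Seq : Set where
  constructor mkSeq
  field
    len : Ord3
    val : Ord3 → ℕ
open Seq public

_≈_ : Seq → Seq → Set
s ≈ t = (len s ≡ len t) × (∀ i → i <ᴼ len s → val s i ≡ val t i)

εˢ : Seq
εˢ = mkSeq ⟨ 0 , 0 , 0 ⟩ (λ _ → 0)

single : ℕ → Seq
single n = mkSeq ⟨ 0 , 0 , 1 ⟩ (λ _ → n)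

_⌢ˢ_ : Seq → Seq → Seq
a ⌢ˢ b = mkSeq (len a +ᴼ len b)
  (λ γ → if ltᴼ γ (len a) then val a γ else val b (γ ∸ᴼ len a))

consˢ : ℕ → Seq → Seq
consˢ n l = single n ⌢ˢ l

consList : List ℕ → Seq → Seq
consList [] l = l
consList (x ∷ xs) l = consˢ x (consList xs l)

-- the ω-sequence w ⌢ N_k, where N_k = (k, k+1, k+2, …)
wN : List ℕ → ℕ → ℕ → ℕ
wN [] k r = k + r
wN (x ∷ w) k zero = x
wN (x ∷ w) k (suc r) = wN w k r

In𝒩 : (ℕ → ℕ) → Set
In𝒩 f = Σ (List ℕ) λ w → Σ ℕ λ k → ∀ r → f r ≡ wN w k r

-- s ∈ 𝔏 = { ⌊𝔩⌋ ⌢ w : w ∈ ℕ*, 𝔩 ∈ 𝒩^β, β < ω² }.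
-- A sequence of length ω²·a + ω·b + n = ω·(ω·a + b) + n is of this form iff
-- each of its ω-blocks (the blocks indexed by β = ω·a + b, i.e. by (p,q) with
-- p < a, or p = a and q < b) lies in 𝒩; the final n entries form w.
In𝔏 : Seq → Set
In𝔏 s = ∀ p q → (p < len s .Ord3.p ⊎ (p ≡ len s .Ord3.p × q < len s .Ord3.q)) →
        In𝒩 (λ r → val s ⟨ p , q , r ⟩)

data ITerm : Set where
  ivar : ℕ → ITerm

data LTerm : Set where
  lvar : ℕ → LTerm                       -- 𝗅𝗂𝗌𝗍-sort variables; lvar 0 is X
  nil  : LTerm
  cons : ITerm → LTerm → LTerm
  _⌢_  : LTerm → LTerm → LTerm

data QFFormula : Set where
  eqI  : ITerm → ITerm → QFFormula
  eqL  : LTerm → LTerm → QFFormula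
  falseF : QFFormula
  notF : QFFormula → QFFormula
  andF : QFFormula → QFFormula → QFFormula
  orF  : QFFormula → QFFormula → QFFormula
  impF : QFFormula → QFFormula → QFFormula

record Env : Set where
  constructor mkEnv
  field
    ienv : ℕ → ℕ
    lenv : ℕ → Seq
open Env public

EnvIn𝔏 : Env → Set
EnvIn𝔏 ρ = ∀ j → In𝔏 (lenv ρ j)

setX : Env → Seq → Env
setX ρ l = mkEnv (ienv ρ) λ { zero → l ; (suc j) → lenv ρ (suc j) }

evalI : Env → ITerm → ℕ
evalI ρ (ivar j) = ienv ρ j

evalL : Env → LTerm → Seq
evalL ρ (lvar j) = lenv ρ j
evalL ρ nil = εˢ
evalL ρ (cons t T) = consˢ (evalI ρ t) (evalL ρ T)
evalL ρ (T ⌢ U) = evalL ρ T ⌢ˢ evalL ρ U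

-- Tarskian satisfaction (classical: all clauses are ¬¬-stable; disjunction
-- is interpreted as ¬(¬A × ¬B))
Sat : Env → QFFormula → Set
Sat ρ (eqI s t) = evalI ρ s ≡ evalI ρ t
Sat ρ (eqL S T) = evalL ρ S ≈ evalL ρ T
Sat ρ falseF = ⊥
Sat ρ (notF φ) = ¬ Sat ρ φ
Sat ρ (andF φ ψ) = Sat ρ φ × Sat ρ ψ
Sat ρ (orF φ ψ) = ¬ (¬ Sat ρ φ × ¬ Sat ρ ψ)
Sat ρ (impF φ ψ) = Sat ρ φ → Sat ρ ψ

-- M₂ ⊨ ∀z⃗ I^m_X φ   (X = list variable 0; z⃗ = all other variables;
-- the bound x₁,…,x_m are fresh, so they are interpreted by arbitrary naturals)

M₂⊨Ind : ℕ → QFFormula → Set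
M₂⊨Ind m φ =
  (ρ : Env) → EnvIn𝔏 ρ →
  ((xs : List ℕ) → Data.List.length xs < m → Sat (setX ρ (consList xs εˢ)) φ) →
  ((L : Seq) → In𝔏 L → (xs : List ℕ) → Data.List.length xs ≡ m →
     Sat (setX ρ L) φ → Sat (setX ρ (consList xs L)) φ) →
  (L : Seq) → In𝔏 L → Sat (setX ρ L) φ

-- Reasoning classically (satisfaction of a quantifier-free formula is ¬¬-stable), every
-- quantifier-free φ(X) is eventually constant: there is a bound B such that φ has the same
-- truth value at all nonempty X whose first entry is at least B.  Indeed a list term in X
-- denotes s₀ ⌢ X ⌢ s₁ ⌢ X ⌢ ⋯ ⌢ c with fixed sᵢ, c; comparing two such terms, either the
-- leading fixed parts have different lengths, and then the first entry of X faces a fixed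
-- entry of the other side, or they have equal length and can be cancelled together with
-- the first X.
--
-- Finite lists satisfy φ by ordinary induction in blocks of m.  An infinite L ∈ 𝔏 starts
-- with an ω-block w ⌢ N_k, so removing a long enough prefix, of length a multiple of m,
-- leaves a suffix T with first entry at least B.  Then T satisfies φ because the
-- one-element list (head of T) does, and m-step induction steps climb back from T to L.

module Submission where

open import Defs
open import Data.Nat using (ℕ; _≥_)

open import Data.Bool using (true; false)
open import Data.List using (List; []; _∷_; length; take; drop; _++_)
open import Data.List.Properties using (length-take; length-drop; take++drop≡id)
open import Data.Nat using (zero; suc; _+_; _*_; _⊔_; _≤_; _<_; z≤n; s≤s; z<s; _<?_; _≡ᵇ_)
open import Data.Nat.Properties
open import Data.Product using (_×_; _,_; proj₁; proj₂; ∃-syntax)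
open import Data.Sum using (_⊎_; inj₁; inj₂)
open import Effect.Monad using (RawMonad)
open import Function using (_∘_)
open import Level using (0ℓ)
open import Relation.Binary.Bundles using (Setoid)
open import Relation.Binary.Definitions using (tri<; tri≈; tri>)
open import Relation.Binary.PropositionalEquality
import Relation.Binary.Reasoning.Setoid as SetoidReasoning
open import Relation.Nullary using (¬_; Dec; yes; no; contradiction)
open import Relation.Nullary.Decidable using (decidable-stable; ¬¬-excluded-middle)
open import Relation.Nullary.Negation using (¬¬-Monad; ¬¬-map; Stable; negated-stable)
open import Relation.Nullary.Reflects using (Reflects; ofʸ; ofⁿ; fromEquivalence; det; _⊎-reflects_; _×-reflects_)

-- Ordinals below ω³

0ᴼ 1ᴼ : Ord3
0ᴼ = ⟨ 0 , 0 , 0 ⟩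
1ᴼ = ⟨ 0 , 0 , 1 ⟩

infix 4 _≺_ _≼_

-- The order computed by ltᴼ, as a relation one can pattern-match on.

_≺_ : Ord3 → Ord3 → Set
⟨ p , q , r ⟩ ≺ ⟨ p' , q' , r' ⟩ = p < p' ⊎ (p ≡ p' × (q < q' ⊎ (q ≡ q' × r < r')))

_≼_ : Ord3 → Ord3 → Set
α ≼ β = α ≺ β ⊎ α ≡ β

≡ᵇ-reflects-≡ : ∀ m n → Reflects (m ≡ n) (m ≡ᵇ n)
≡ᵇ-reflects-≡ m n = fromEquivalence (≡ᵇ⇒≡ m n) (≡⇒≡ᵇ m n)

ltᴼ-reflects-≺ : ∀ α β → Reflects (α ≺ β) (ltᴼ α β)
ltᴼ-reflects-≺ ⟨ p , q , r ⟩ ⟨ p' , q' , r' ⟩ =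
  <ᵇ-reflects-< p p' ⊎-reflects ≡ᵇ-reflects-≡ p p' ×-reflects
  (<ᵇ-reflects-< q q' ⊎-reflects ≡ᵇ-reflects-≡ q q' ×-reflects <ᵇ-reflects-< r r')

≺⇒ltᴼ≡true : ∀ {α β} → α ≺ β → ltᴼ α β ≡ true
≺⇒ltᴼ≡true {α} {β} α≺β = det (ltᴼ-reflects-≺ α β) (ofʸ α≺β)

⊀⇒ltᴼ≡false : ∀ {α β} → ¬ α ≺ β → ltᴼ α β ≡ false
⊀⇒ltᴼ≡false {α} {β} α⊀β = det (ltᴼ-reflects-≺ α β) (ofⁿ α⊀β)

<ᴼ⇒≺ : ∀ {α β} → α <ᴼ β → α ≺ β
<ᴼ⇒≺ {α} {β} α<β with ltᴼ α β | ltᴼ-reflects-≺ α β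
... | true | ofʸ α≺β = α≺β

≺⇒<ᴼ : ∀ {α β} → α ≺ β → α <ᴼ β
≺⇒<ᴼ α≺β rewrite ≺⇒ltᴼ≡true α≺β = _

≺-irrefl : ∀ {α} → ¬ α ≺ α
≺-irrefl (inj₁ p<p) = <-irrefl refl p<p
≺-irrefl (inj₂ (_ , inj₁ q<q)) = <-irrefl refl q<q
≺-irrefl (inj₂ (_ , inj₂ (_ , r<r))) = <-irrefl refl r<r

≺-trans : ∀ {α β γ} → α ≺ β → β ≺ γ → α ≺ γ
≺-trans (inj₁ p<p') (inj₁ p'<p'') = inj₁ (<-trans p<p' p'<p'')
≺-trans (inj₁ p<p') (inj₂ (refl , _)) = inj₁ p<p'
≺-trans (inj₂ (refl , _)) (inj₁ p<p'') = inj₁ p<p''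
≺-trans (inj₂ (refl , inj₁ q<q')) (inj₂ (refl , inj₁ q'<q'')) = inj₂ (refl , inj₁ (<-trans q<q' q'<q''))
≺-trans (inj₂ (refl , inj₁ q<q')) (inj₂ (refl , inj₂ (refl , _))) = inj₂ (refl , inj₁ q<q')
≺-trans (inj₂ (refl , inj₂ (refl , _))) (inj₂ (refl , inj₁ q<q'')) = inj₂ (refl , inj₁ q<q'')
≺-trans (inj₂ (refl , inj₂ (refl , r<r'))) (inj₂ (refl , inj₂ (refl , r'<r''))) =
  inj₂ (refl , inj₂ (refl , <-trans r<r' r'<r''))

≺-trichotomy : ∀ α β → α ≺ β ⊎ α ≡ β ⊎ β ≺ α
≺-trichotomy ⟨ p , q , r ⟩ ⟨ p' , q' , r' ⟩ with <-cmp p p' | <-cmp q q' | <-cmp r r'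
... | tri< p<p' _ _ | _ | _ = inj₁ (inj₁ p<p')
... | tri> _ _ p>p' | _ | _ = inj₂ (inj₂ (inj₁ p>p'))
... | tri≈ _ refl _ | tri< q<q' _ _ | _ = inj₁ (inj₂ (refl , inj₁ q<q'))
... | tri≈ _ refl _ | tri> _ _ q>q' | _ = inj₂ (inj₂ (inj₂ (refl , inj₁ q>q')))
... | tri≈ _ refl _ | tri≈ _ refl _ | tri< r<r' _ _ = inj₁ (inj₂ (refl , inj₂ (refl , r<r')))
... | tri≈ _ refl _ | tri≈ _ refl _ | tri> _ _ r>r' = inj₂ (inj₂ (inj₂ (refl , inj₂ (refl , r>r'))))
... | tri≈ _ refl _ | tri≈ _ refl _ | tri≈ _ refl _ = inj₂ (inj₁ refl)

⊀0ᴼ : ∀ {α} → ¬ α ≺ 0ᴼ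
⊀0ᴼ {⟨ _ , _ , _ ⟩} (inj₂ (_ , inj₂ (_ , ())))

≺1ᴼ⇒≡0ᴼ : ∀ {α} → α ≺ 1ᴼ → α ≡ 0ᴼ
≺1ᴼ⇒≡0ᴼ {⟨ zero , zero , zero ⟩} _ = refl
≺1ᴼ⇒≡0ᴼ {⟨ _ , _ , suc _ ⟩} (inj₂ (refl , inj₂ (refl , s≤s ())))

+ᴼ-identityˡ : ∀ α → 0ᴼ +ᴼ α ≡ α
+ᴼ-identityˡ ⟨ zero , zero , r ⟩ = refl
+ᴼ-identityˡ ⟨ zero , suc q , r ⟩ = refl
+ᴼ-identityˡ ⟨ suc p , q , r ⟩ = refl

+ᴼ-identityʳ : ∀ α → α +ᴼ 0ᴼ ≡ α
+ᴼ-identityʳ ⟨ p , q , r ⟩ = cong ⟨ p , q ,_⟩ (+-identityʳ r)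

+ᴼ-assoc : ∀ α β γ → (α +ᴼ β) +ᴼ γ ≡ α +ᴼ (β +ᴼ γ)
+ᴼ-assoc ⟨ p , q , r ⟩ ⟨ zero , zero , c ⟩ ⟨ zero , zero , c' ⟩ = cong ⟨ p , q ,_⟩ (+-assoc r c c')
+ᴼ-assoc ⟨ p , q , r ⟩ ⟨ zero , zero , c ⟩ ⟨ zero , suc b' , c' ⟩ = refl
+ᴼ-assoc ⟨ p , q , r ⟩ ⟨ zero , zero , c ⟩ ⟨ suc a' , b' , c' ⟩ = refl
+ᴼ-assoc ⟨ p , q , r ⟩ ⟨ zero , suc b , c ⟩ ⟨ zero , zero , c' ⟩ = refl
+ᴼ-assoc ⟨ p , q , r ⟩ ⟨ zero , suc b , c ⟩ ⟨ zero , suc b' , c' ⟩ = cong ⟨ p ,_, c' ⟩ (+-assoc q (suc b) (suc b'))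
+ᴼ-assoc ⟨ p , q , r ⟩ ⟨ zero , suc b , c ⟩ ⟨ suc a' , b' , c' ⟩ = refl
+ᴼ-assoc ⟨ p , q , r ⟩ ⟨ suc a , b , c ⟩ ⟨ zero , zero , c' ⟩ = refl
+ᴼ-assoc ⟨ p , q , r ⟩ ⟨ suc a , b , c ⟩ ⟨ zero , suc b' , c' ⟩ = refl
+ᴼ-assoc ⟨ p , q , r ⟩ ⟨ suc a , b , c ⟩ ⟨ suc a' , b' , c' ⟩ = cong ⟨_, b' , c' ⟩ (+-assoc p (suc a) (suc a'))

α≼α+ᴼδ : ∀ α δ → α ≼ α +ᴼ δ
α≼α+ᴼδ ⟨ p , q , r ⟩ ⟨ zero , zero , zero ⟩ = inj₂ (cong ⟨ p , q ,_⟩ (sym (+-identityʳ r)))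
α≼α+ᴼδ ⟨ p , q , r ⟩ ⟨ zero , zero , suc c ⟩ = inj₁ (inj₂ (refl , inj₂ (refl , m<m+n r z<s)))
α≼α+ᴼδ ⟨ p , q , r ⟩ ⟨ zero , suc b , c ⟩ = inj₁ (inj₂ (refl , inj₁ (m<m+n q z<s)))
α≼α+ᴼδ ⟨ p , q , r ⟩ ⟨ suc a , b , c ⟩ = inj₁ (inj₁ (m<m+n p z<s))

≺⇒≺+ᴼ : ∀ {α β} γ → α ≺ β → α ≺ β +ᴼ γ
≺⇒≺+ᴼ {β = β} γ α≺β with α≼α+ᴼδ β γ
... | inj₁ β≺β+γ = ≺-trans α≺β β≺β+γ
... | inj₂ β≡β+γ = subst (_ ≺_) β≡β+γ α≺β

α+ᴼδ⊀α : ∀ α δ → ¬ α +ᴼ δ ≺ α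
α+ᴼδ⊀α α δ α+δ≺α with α≼α+ᴼδ α δ
... | inj₁ α≺α+δ = ≺-irrefl (≺-trans α≺α+δ α+δ≺α)
... | inj₂ α≡α+δ = ≺-irrefl (subst (_≺ α) (sym α≡α+δ) α+δ≺α)

+ᴼ-monoʳ-≺ : ∀ α {δ β} → δ ≺ β → α +ᴼ δ ≺ α +ᴼ β
+ᴼ-monoʳ-≺ ⟨ p , q , r ⟩ {⟨ zero , zero , c ⟩} {⟨ zero , zero , c' ⟩} (inj₂ (_ , inj₂ (_ , c<c'))) =
  inj₂ (refl , inj₂ (refl , +-monoʳ-< r c<c'))
+ᴼ-monoʳ-≺ ⟨ p , q , r ⟩ {⟨ zero , zero , c ⟩} {⟨ zero , zero , c' ⟩} (inj₂ (_ , inj₁ ()))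
+ᴼ-monoʳ-≺ ⟨ p , q , r ⟩ {⟨ zero , zero , c ⟩} {⟨ zero , suc b , c' ⟩} _ =
  inj₂ (refl , inj₁ (m<m+n q z<s))
+ᴼ-monoʳ-≺ ⟨ p , q , r ⟩ {⟨ zero , zero , c ⟩} {⟨ suc a , b , c' ⟩} _ = inj₁ (m<m+n p z<s)
+ᴼ-monoʳ-≺ ⟨ p , q , r ⟩ {⟨ zero , suc b , c ⟩} {⟨ zero , zero , c' ⟩} (inj₂ (_ , inj₁ ()))
+ᴼ-monoʳ-≺ ⟨ p , q , r ⟩ {⟨ zero , suc b , c ⟩} {⟨ zero , zero , c' ⟩} (inj₂ (_ , inj₂ (() , _)))
+ᴼ-monoʳ-≺ ⟨ p , q , r ⟩ {⟨ zero , suc b , c ⟩} {⟨ zero , suc b' , c' ⟩} (inj₂ (_ , inj₁ b<b')) =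
  inj₂ (refl , inj₁ (+-monoʳ-< q b<b'))
+ᴼ-monoʳ-≺ ⟨ p , q , r ⟩ {⟨ zero , suc b , c ⟩} {⟨ zero , suc b' , c' ⟩} (inj₂ (_ , inj₂ (b≡b' , c<c'))) =
  inj₂ (refl , inj₂ (cong (q +_) b≡b' , c<c'))
+ᴼ-monoʳ-≺ ⟨ p , q , r ⟩ {⟨ zero , suc b , c ⟩} {⟨ suc a , b' , c' ⟩} _ = inj₁ (m<m+n p z<s)
+ᴼ-monoʳ-≺ ⟨ p , q , r ⟩ {⟨ suc a , b , c ⟩} {⟨ zero , b' , c' ⟩} (inj₂ (() , _))
+ᴼ-monoʳ-≺ ⟨ p , q , r ⟩ {⟨ suc a , b , c ⟩} {⟨ suc a' , b' , c' ⟩} (inj₁ a<a') =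
  inj₁ (+-monoʳ-< p a<a')
+ᴼ-monoʳ-≺ ⟨ p , q , r ⟩ {⟨ suc a , b , c ⟩} {⟨ suc a' , b' , c' ⟩} (inj₂ (a≡a' , b≺b')) =
  inj₂ (cong (p +_) a≡a' , b≺b')

+ᴼ-cancelˡ-≺ : ∀ α {δ β} → α +ᴼ δ ≺ α +ᴼ β → δ ≺ β
+ᴼ-cancelˡ-≺ α {δ} {β} α+δ≺α+β with ≺-trichotomy δ β
... | inj₁ δ≺β = δ≺β
... | inj₂ (inj₁ refl) = contradiction α+δ≺α+β ≺-irrefl
... | inj₂ (inj₂ β≺δ) = contradiction (≺-trans α+δ≺α+β (+ᴼ-monoʳ-≺ α β≺δ)) ≺-irrefl

+ᴼ-∸ᴼ : ∀ α δ → (α +ᴼ δ) ∸ᴼ α ≡ δ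
+ᴼ-∸ᴼ ⟨ p , q , r ⟩ ⟨ zero , zero , c ⟩
  rewrite det (≡ᵇ-reflects-≡ p p) (ofʸ refl) | det (≡ᵇ-reflects-≡ q q) (ofʸ refl) =
  cong ⟨ 0 , 0 ,_⟩ (m+n∸m≡n r c)
+ᴼ-∸ᴼ ⟨ p , q , r ⟩ ⟨ zero , suc b , c ⟩
  rewrite det (≡ᵇ-reflects-≡ p p) (ofʸ refl) | det (≡ᵇ-reflects-≡ q (q + suc b)) (ofⁿ (m+1+n≢m q ∘ sym)) =
  cong ⟨ 0 ,_, c ⟩ (m+n∸m≡n q (suc b))
+ᴼ-∸ᴼ ⟨ p , q , r ⟩ ⟨ suc a , b , c ⟩
  rewrite det (≡ᵇ-reflects-≡ p (p + suc a)) (ofⁿ (m+1+n≢m p ∘ sym)) =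
  cong ⟨_, b , c ⟩ (m+n∸m≡n p (suc a))

≺⊎≡+ᴼ : ∀ α i → i ≺ α ⊎ ∃[ δ ] i ≡ α +ᴼ δ
≺⊎≡+ᴼ ⟨ p , q , r ⟩ ⟨ p' , q' , r' ⟩ with <-cmp p' p
... | tri< p'<p _ _ = inj₁ (inj₁ p'<p)
... | tri> _ _ p<p' = let (k , eq) = m≤n⇒∃[o]m+o≡n p<p' in
  inj₂ (⟨ suc k , q' , r' ⟩ , cong ⟨_, q' , r' ⟩ (trans (sym eq) (sym (+-suc p k))))
... | tri≈ _ refl _ with <-cmp q' q
...   | tri< q'<q _ _ = inj₁ (inj₂ (refl , inj₁ q'<q))
...   | tri> _ _ q<q' = let (k , eq) = m≤n⇒∃[o]m+o≡n q<q' in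
  inj₂ (⟨ 0 , suc k , r' ⟩ , cong ⟨ p ,_, r' ⟩ (trans (sym eq) (sym (+-suc q k))))
...   | tri≈ _ refl _ with r' <? r
...     | yes r'<r = inj₁ (inj₂ (refl , inj₂ (refl , r'<r)))
...     | no r'≮r = let (k , eq) = m≤n⇒∃[o]m+o≡n (≮⇒≥ r'≮r) in
  inj₂ (⟨ 0 , 0 , k ⟩ , cong ⟨ p , q ,_⟩ (sym eq))

-- Sequences up to ≈

≈-intro : ∀ {s t} → len s ≡ len t → (∀ i → i ≺ len s → val s i ≡ val t i) → s ≈ t
≈-intro s≡t vals = s≡t , λ i i<s → vals i (<ᴼ⇒≺ i<s)

≈-val : ∀ {s t i} → s ≈ t → i ≺ len s → val s i ≡ val t i
≈-val (_ , vals) i≺s = vals _ (≺⇒<ᴼ i≺s)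

≈-refl : ∀ {s} → s ≈ s
≈-refl = refl , λ _ _ → refl

≈-sym : ∀ {s t} → s ≈ t → t ≈ s
≈-sym s≈t@(s≡t , _) = ≈-intro (sym s≡t) λ i i≺t → sym (≈-val s≈t (subst (i ≺_) (sym s≡t) i≺t))

≈-trans : ∀ {s t u} → s ≈ t → t ≈ u → s ≈ u
≈-trans s≈t@(s≡t , _) t≈u@(t≡u , _) =
  ≈-intro (trans s≡t t≡u) λ i i≺s → trans (≈-val s≈t i≺s) (≈-val t≈u (subst (i ≺_) s≡t i≺s))

≈-setoid : Setoid 0ℓ 0ℓ
≈-setoid = record
  { Carrier = Seq
  ; _≈_ = _≈_
  ; isEquivalence = record { refl = ≈-refl ; sym = ≈-sym ; trans = ≈-trans }
  }

⌢-val-< : ∀ a b {i} → i ≺ len a → val (a ⌢ˢ b) i ≡ val a i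
⌢-val-< a b i≺a rewrite ≺⇒ltᴼ≡true i≺a = refl

⌢-val-+ : ∀ a b δ → val (a ⌢ˢ b) (len a +ᴼ δ) ≡ val b δ
⌢-val-+ a b δ rewrite ⊀⇒ltᴼ≡false (α+ᴼδ⊀α (len a) δ) | +ᴼ-∸ᴼ (len a) δ = refl

⌢-cong : ∀ {a a' b b'} → a ≈ a' → b ≈ b' → (a ⌢ˢ b) ≈ (a' ⌢ˢ b')
⌢-cong {a} {a'} {b} {b'} a≈a'@(a≡a' , _) b≈b'@(b≡b' , _) = ≈-intro (cong₂ _+ᴼ_ a≡a' b≡b') vals
  where
  vals : ∀ i → i ≺ len a +ᴼ len b → val (a ⌢ˢ b) i ≡ val (a' ⌢ˢ b') i
  vals i i≺ with ≺⊎≡+ᴼ (len a) i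
  ... | inj₁ i≺a = begin
    val (a ⌢ˢ b) i    ≡⟨ ⌢-val-< a b i≺a ⟩
    val a i           ≡⟨ ≈-val a≈a' i≺a ⟩
    val a' i          ≡⟨ ⌢-val-< a' b' (subst (i ≺_) a≡a' i≺a) ⟨
    val (a' ⌢ˢ b') i  ∎
    where open ≡-Reasoning
  ... | inj₂ (δ , refl) = begin
    val (a ⌢ˢ b) (len a +ᴼ δ)     ≡⟨ ⌢-val-+ a b δ ⟩
    val b δ                       ≡⟨ ≈-val b≈b' (+ᴼ-cancelˡ-≺ (len a) i≺) ⟩
    val b' δ                      ≡⟨ ⌢-val-+ a' b' δ ⟨
    val (a' ⌢ˢ b') (len a' +ᴼ δ)  ≡⟨ cong (λ α → val (a' ⌢ˢ b') (α +ᴼ δ)) a≡a' ⟨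
    val (a' ⌢ˢ b') (len a +ᴼ δ)   ∎
    where open ≡-Reasoning

⌢-congˡ : ∀ a {b b'} → b ≈ b' → (a ⌢ˢ b) ≈ (a ⌢ˢ b')
⌢-congˡ a = ⌢-cong (≈-refl {a})

⌢-congʳ : ∀ {a a'} b → a ≈ a' → (a ⌢ˢ b) ≈ (a' ⌢ˢ b)
⌢-congʳ b a≈a' = ⌢-cong a≈a' (≈-refl {b})

⌢-assoc : ∀ a b c → ((a ⌢ˢ b) ⌢ˢ c) ≈ (a ⌢ˢ (b ⌢ˢ c))
⌢-assoc a b c = ≈-intro (+ᴼ-assoc (len a) (len b) (len c)) vals
  where
  open ≡-Reasoning
  vals : ∀ i → i ≺ (len a +ᴼ len b) +ᴼ len c → val ((a ⌢ˢ b) ⌢ˢ c) i ≡ val (a ⌢ˢ (b ⌢ˢ c)) i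
  vals i _ with ≺⊎≡+ᴼ (len a) i
  ... | inj₁ i≺a = begin
    val ((a ⌢ˢ b) ⌢ˢ c) i  ≡⟨ ⌢-val-< (a ⌢ˢ b) c (≺⇒≺+ᴼ (len b) i≺a) ⟩
    val (a ⌢ˢ b) i         ≡⟨ ⌢-val-< a b i≺a ⟩
    val a i                ≡⟨ ⌢-val-< a (b ⌢ˢ c) i≺a ⟨
    val (a ⌢ˢ (b ⌢ˢ c)) i  ∎
  ... | inj₂ (δ , refl) with ≺⊎≡+ᴼ (len b) δ
  ...   | inj₁ δ≺b = begin
    val ((a ⌢ˢ b) ⌢ˢ c) (len a +ᴼ δ)  ≡⟨ ⌢-val-< (a ⌢ˢ b) c (+ᴼ-monoʳ-≺ (len a) δ≺b) ⟩
    val (a ⌢ˢ b) (len a +ᴼ δ)         ≡⟨ ⌢-val-+ a b δ ⟩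
    val b δ                           ≡⟨ ⌢-val-< b c δ≺b ⟨
    val (b ⌢ˢ c) δ                    ≡⟨ ⌢-val-+ a (b ⌢ˢ c) δ ⟨
    val (a ⌢ˢ (b ⌢ˢ c)) (len a +ᴼ δ)  ∎
  ...   | inj₂ (ε , refl) = begin
    val ((a ⌢ˢ b) ⌢ˢ c) (len a +ᴼ (len b +ᴼ ε))  ≡⟨ cong (val ((a ⌢ˢ b) ⌢ˢ c)) (+ᴼ-assoc (len a) (len b) ε) ⟨
    val ((a ⌢ˢ b) ⌢ˢ c) ((len a +ᴼ len b) +ᴼ ε)  ≡⟨ ⌢-val-+ (a ⌢ˢ b) c ε ⟩
    val c ε                                      ≡⟨ ⌢-val-+ b c ε ⟨
    val (b ⌢ˢ c) (len b +ᴼ ε)                    ≡⟨ ⌢-val-+ a (b ⌢ˢ c) (len b +ᴼ ε) ⟨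
    val (a ⌢ˢ (b ⌢ˢ c)) (len a +ᴼ (len b +ᴼ ε))  ∎

⌢-identityʳ : ∀ a → (a ⌢ˢ εˢ) ≈ a
⌢-identityʳ a = ≈-intro (+ᴼ-identityʳ (len a))
  λ i i≺ → ⌢-val-< a εˢ (subst (i ≺_) (+ᴼ-identityʳ (len a)) i≺)

⌢-cancelˡ : ∀ a b c → (a ⌢ˢ b) ≈ (a ⌢ˢ c) → b ≈ c
⌢-cancelˡ a b c ab≈ac@(ab≡ac , _) = ≈-intro b≡c vals
  where
  open ≡-Reasoning
  b≡c : len b ≡ len c
  b≡c = begin
    len b                        ≡⟨ +ᴼ-∸ᴼ (len a) (len b) ⟨
    (len a +ᴼ len b) ∸ᴼ len a    ≡⟨ cong (_∸ᴼ len a) ab≡ac ⟩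
    (len a +ᴼ len c) ∸ᴼ len a    ≡⟨ +ᴼ-∸ᴼ (len a) (len c) ⟩
    len c                        ∎
  vals : ∀ i → i ≺ len b → val b i ≡ val c i
  vals i i≺b = begin
    val b i                    ≡⟨ ⌢-val-+ a b i ⟨
    val (a ⌢ˢ b) (len a +ᴼ i)  ≡⟨ ≈-val ab≈ac (+ᴼ-monoʳ-≺ (len a) i≺b) ⟩
    val (a ⌢ˢ c) (len a +ᴼ i)  ≡⟨ ⌢-val-+ a c i ⟩
    val c i                    ∎

⌢-prefix-≈ : ∀ {s s'} u u' → len s ≡ len s' → (s ⌢ˢ u) ≈ (s' ⌢ˢ u') → s ≈ s'
⌢-prefix-≈ {s} {s'} u u' s≡s' su≈s'u' = ≈-intro s≡s' λ i i≺s → begin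
  val s i           ≡⟨ ⌢-val-< s u i≺s ⟨
  val (s ⌢ˢ u) i    ≡⟨ ≈-val su≈s'u' (≺⇒≺+ᴼ (len u) i≺s) ⟩
  val (s' ⌢ˢ u') i  ≡⟨ ⌢-val-< s' u' (subst (i ≺_) s≡s' i≺s) ⟩
  val s' i          ∎
  where open ≡-Reasoning

⌢-identityˡ : ∀ a → (εˢ ⌢ˢ a) ≈ a
⌢-identityˡ a = ≈-intro (+ᴼ-identityˡ (len a)) vals
  where
  vals : ∀ i → i ≺ 0ᴼ +ᴼ len a → val (εˢ ⌢ˢ a) i ≡ val a i
  vals i _ with ≺⊎≡+ᴼ 0ᴼ i
  ... | inj₁ i≺0 = contradiction i≺0 ⊀0ᴼ
  ... | inj₂ (δ , refl) = trans (⌢-val-+ εˢ a δ) (cong (val a) (sym (+ᴼ-identityˡ δ)))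

α≺α+ᴼβ : ∀ α {β} → 0ᴼ ≺ β → α ≺ α +ᴼ β
α≺α+ᴼβ α {β} 0≺β = subst (_≺ α +ᴼ β) (+ᴼ-identityʳ α) (+ᴼ-monoʳ-≺ α 0≺β)

⌢-val-middle : ∀ s X r → 0ᴼ ≺ len X → val (s ⌢ˢ (X ⌢ˢ r)) (len s) ≡ val X 0ᴼ
⌢-val-middle s X r 0≺X = begin
  val (s ⌢ˢ (X ⌢ˢ r)) (len s)          ≡⟨ cong (val (s ⌢ˢ (X ⌢ˢ r))) (+ᴼ-identityʳ (len s)) ⟨
  val (s ⌢ˢ (X ⌢ˢ r)) (len s +ᴼ 0ᴼ)    ≡⟨ ⌢-val-+ s (X ⌢ˢ r) 0ᴼ ⟩
  val (X ⌢ˢ r) 0ᴼ                      ≡⟨ ⌢-val-< X r 0≺X ⟩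
  val X 0ᴼ                             ∎
  where open ≡-Reasoning

mismatch : ∀ s X r c → 0ᴼ ≺ len X → val c (len s) ≢ val X 0ᴼ → ¬ ((s ⌢ˢ (X ⌢ˢ r)) ≈ c)
mismatch s X r c 0≺X c≢X sXr≈c = c≢X (begin
  val c (len s)                ≡⟨ ≈-val sXr≈c s≺sXr ⟨
  val (s ⌢ˢ (X ⌢ˢ r)) (len s)  ≡⟨ ⌢-val-middle s X r 0≺X ⟩
  val X 0ᴼ                     ∎)
  where
  open ≡-Reasoning
  s≺sXr : len s ≺ len s +ᴼ (len X +ᴼ len r)
  s≺sXr = α≺α+ᴼβ (len s) (≺⇒≺+ᴼ (len r) 0≺X)

evalL-cong : ∀ ρ T {X Y} → X ≈ Y → evalL (setX ρ X) T ≈ evalL (setX ρ Y) T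
evalL-cong ρ (lvar zero) X≈Y = X≈Y
evalL-cong ρ (lvar (suc j)) X≈Y = ≈-refl
evalL-cong ρ nil X≈Y = ≈-refl
evalL-cong ρ (cons (ivar i) T) X≈Y = ⌢-congˡ (single (ienv ρ i)) (evalL-cong ρ T X≈Y)
evalL-cong ρ (T ⌢ U) X≈Y = ⌢-cong (evalL-cong ρ T X≈Y) (evalL-cong ρ U X≈Y)

Sat-cong : ∀ ρ φ {X Y} → X ≈ Y → Sat (setX ρ X) φ → Sat (setX ρ Y) φ
Sat-cong ρ (eqI (ivar i) (ivar j)) X≈Y i≡j = i≡j
Sat-cong ρ (eqL S T) X≈Y S≈T =
  ≈-trans (evalL-cong ρ S (≈-sym X≈Y)) (≈-trans S≈T (evalL-cong ρ T X≈Y))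
Sat-cong ρ falseF X≈Y ()
Sat-cong ρ (notF φ) X≈Y ¬φ φ' = ¬φ (Sat-cong ρ φ (≈-sym X≈Y) φ')
Sat-cong ρ (andF φ ψ) X≈Y (φ' , ψ') = Sat-cong ρ φ X≈Y φ' , Sat-cong ρ ψ X≈Y ψ'
Sat-cong ρ (orF φ ψ) X≈Y φ∨ψ (¬φ , ¬ψ) =
  φ∨ψ ((λ φ' → ¬φ (Sat-cong ρ φ X≈Y φ')) , (λ ψ' → ¬ψ (Sat-cong ρ ψ X≈Y ψ')))
Sat-cong ρ (impF φ ψ) X≈Y φ⇒ψ φ' = Sat-cong ρ ψ X≈Y (φ⇒ψ (Sat-cong ρ φ (≈-sym X≈Y) φ'))

≡ᴼ-stable : ∀ {α β : Ord3} → Stable (α ≡ β)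
≡ᴼ-stable {α} {β} ¬¬α≡β with ≺-trichotomy α β
... | inj₁ α≺β = contradiction (λ { refl → ≺-irrefl α≺β }) ¬¬α≡β
... | inj₂ (inj₁ α≡β) = α≡β
... | inj₂ (inj₂ β≺α) = contradiction (λ { refl → ≺-irrefl β≺α }) ¬¬α≡β

≈-stable : ∀ {s t} → Stable (s ≈ t)
≈-stable ¬¬s≈t = ≡ᴼ-stable (¬¬-map proj₁ ¬¬s≈t) ,
  λ i i<s → decidable-stable (_ ≟ _) (¬¬-map (λ s≈t → proj₂ s≈t i i<s) ¬¬s≈t)

Sat-stable : ∀ ρ φ → Stable (Sat ρ φ)
Sat-stable ρ (eqI s t) = decidable-stable (_ ≟ _)
Sat-stable ρ (eqL S T) = ≈-stable
Sat-stable ρ falseF ¬¬⊥ = ¬¬⊥ (λ ())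
Sat-stable ρ (notF φ) = negated-stable
Sat-stable ρ (andF φ ψ) ¬¬φ∧ψ =
  Sat-stable ρ φ (¬¬-map proj₁ ¬¬φ∧ψ) , Sat-stable ρ ψ (¬¬-map proj₂ ¬¬φ∧ψ)
Sat-stable ρ (orF φ ψ) = negated-stable
Sat-stable ρ (impF φ ψ) ¬¬φ⇒ψ φ' = Sat-stable ρ ψ (¬¬-map (λ φ⇒ψ → φ⇒ψ φ') ¬¬φ⇒ψ)

-- List terms as functions of X

infixr 5 _⌢X⌢_

-- A list term with its parameters fixed, in the form s₀ ⌢ X ⌢ s₁ ⌢ X ⌢ ⋯ ⌢ c.
data Shape : Set where
  const : Seq → Shape
  _⌢X⌢_ : Seq → Shape → Shape

⟦_⟧ : Shape → Seq → Seq
⟦ const c ⟧ X = c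
⟦ s ⌢X⌢ A ⟧ X = s ⌢ˢ (X ⌢ˢ ⟦ A ⟧ X)

prepend : Seq → Shape → Shape
prepend c (const d) = const (c ⌢ˢ d)
prepend c (s ⌢X⌢ A) = (c ⌢ˢ s) ⌢X⌢ A

infixr 5 _⊕_

_⊕_ : Shape → Shape → Shape
const c ⊕ B = prepend c B
(s ⌢X⌢ A) ⊕ B = s ⌢X⌢ (A ⊕ B)

⟦prepend⟧ : ∀ c A X → ⟦ prepend c A ⟧ X ≈ (c ⌢ˢ ⟦ A ⟧ X)
⟦prepend⟧ c (const d) X = ≈-refl
⟦prepend⟧ c (s ⌢X⌢ A) X = ⌢-assoc c s (X ⌢ˢ ⟦ A ⟧ X)

⟦⊕⟧ : ∀ A B X → ⟦ A ⊕ B ⟧ X ≈ (⟦ A ⟧ X ⌢ˢ ⟦ B ⟧ X)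
⟦⊕⟧ (const c) B X = ⟦prepend⟧ c B X
⟦⊕⟧ (s ⌢X⌢ A) B X = begin
  s ⌢ˢ (X ⌢ˢ ⟦ A ⊕ B ⟧ X)               ≈⟨ ⌢-congˡ s (⌢-congˡ X (⟦⊕⟧ A B X)) ⟩
  s ⌢ˢ (X ⌢ˢ (⟦ A ⟧ X ⌢ˢ ⟦ B ⟧ X))      ≈⟨ ⌢-congˡ s (⌢-assoc X (⟦ A ⟧ X) (⟦ B ⟧ X)) ⟨
  s ⌢ˢ ((X ⌢ˢ ⟦ A ⟧ X) ⌢ˢ ⟦ B ⟧ X)      ≈⟨ ⌢-assoc s (X ⌢ˢ ⟦ A ⟧ X) (⟦ B ⟧ X) ⟨
  (s ⌢ˢ (X ⌢ˢ ⟦ A ⟧ X)) ⌢ˢ ⟦ B ⟧ X      ∎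
  where open SetoidReasoning ≈-setoid

shape : Env → LTerm → Shape
shape ρ (lvar zero) = εˢ ⌢X⌢ const εˢ
shape ρ (lvar (suc j)) = const (lenv ρ (suc j))
shape ρ nil = const εˢ
shape ρ (cons t T) = prepend (single (evalI ρ t)) (shape ρ T)
shape ρ (T ⌢ U) = shape ρ T ⊕ shape ρ U

shape-sound : ∀ ρ T X → evalL (setX ρ X) T ≈ ⟦ shape ρ T ⟧ X
shape-sound ρ (lvar zero) X = ≈-sym (≈-trans (⌢-identityˡ (X ⌢ˢ εˢ)) (⌢-identityʳ X))
shape-sound ρ (lvar (suc j)) X = ≈-refl
shape-sound ρ nil X = ≈-refl
shape-sound ρ (cons (ivar i) T) X =
  ≈-trans (⌢-congˡ (single (ienv ρ i)) (shape-sound ρ T X))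
          (≈-sym (⟦prepend⟧ (single (ienv ρ i)) (shape ρ T) X))
shape-sound ρ (T ⌢ U) X =
  ≈-trans (⌢-cong (shape-sound ρ T X) (shape-sound ρ U X)) (≈-sym (⟦⊕⟧ (shape ρ T) (shape ρ U) X))

-- Eventual constancy of quantifier-free formulas

open RawMonad (¬¬-Monad {0ℓ})

HeadAtLeast : ℕ → Seq → Set
HeadAtLeast B X = 0ᴼ ≺ len X × B ≤ val X 0ᴼ

EventuallyDecided : Shape → Shape → Set
EventuallyDecided A A' =
  (∀ X → ⟦ A ⟧ X ≈ ⟦ A' ⟧ X) ⊎ ∃[ B ] (∀ X → HeadAtLeast B X → ¬ (⟦ A ⟧ X ≈ ⟦ A' ⟧ X))

⌢X⌢≉const : ∀ s A c X → HeadAtLeast (suc (val c (len s))) X → ¬ (⟦ s ⌢X⌢ A ⟧ X ≈ c)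
⌢X⌢≉const s A c X (0≺X , c<X) = mismatch s X (⟦ A ⟧ X) c 0≺X (<⇒≢ c<X)

⌢X⌢≉⌢X⌢ : ∀ s A s' A' X → len s ≺ len s' → HeadAtLeast (suc (val s' (len s))) X →
          ¬ (⟦ s ⌢X⌢ A ⟧ X ≈ ⟦ s' ⌢X⌢ A' ⟧ X)
⌢X⌢≉⌢X⌢ s A s' A' X s≺s' (0≺X , s'<X) =
  mismatch s X (⟦ A ⟧ X) (⟦ s' ⌢X⌢ A' ⟧ X) 0≺X
    (<⇒≢ (subst (_< val X 0ᴼ) (sym (⌢-val-< s' (X ⌢ˢ ⟦ A' ⟧ X) s≺s')) s'<X))

decide-shapes : ∀ A A' → ¬ ¬ EventuallyDecided A A'
decide-shapes (const c) (const c') = ¬¬-map decided ¬¬-excluded-middle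
  where
  decided : Dec (c ≈ c') → EventuallyDecided (const c) (const c')
  decided (yes c≈c') = inj₁ λ _ → c≈c'
  decided (no c≉c') = inj₂ (0 , λ _ _ → c≉c')
decide-shapes (s ⌢X⌢ A) (const c) = pure (inj₂ (_ , ⌢X⌢≉const s A c))
decide-shapes (const c) (s ⌢X⌢ A) = pure (inj₂ (_ , λ X X≥ eq → ⌢X⌢≉const s A c X X≥ (≈-sym eq)))
decide-shapes (s ⌢X⌢ A) (s' ⌢X⌢ A') with ≺-trichotomy (len s) (len s')
... | inj₁ s≺s' = pure (inj₂ (_ , λ X X≥ → ⌢X⌢≉⌢X⌢ s A s' A' X s≺s' X≥))
... | inj₂ (inj₂ s'≺s) = pure (inj₂ (_ , λ X X≥ eq → ⌢X⌢≉⌢X⌢ s' A' s A X s'≺s X≥ (≈-sym eq)))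
... | inj₂ (inj₁ s≡s') = do
  yes s≈s' ← ¬¬-excluded-middle
    where no s≉s' → pure (inj₂ (0 , λ X _ eq →
                      s≉s' (⌢-prefix-≈ (X ⌢ˢ ⟦ A ⟧ X) (X ⌢ˢ ⟦ A' ⟧ X) s≡s' eq)))
  inj₁ A≈A' ← decide-shapes A A'
    where inj₂ (B , A≉A') → pure (inj₂ (B , λ X X≥ eq → A≉A' X X≥ (cancel s≈s' X eq)))
  pure (inj₁ λ X → ⌢-cong s≈s' (⌢-congˡ X (A≈A' X)))
  where
  cancel : s ≈ s' → ∀ X → ⟦ s ⌢X⌢ A ⟧ X ≈ ⟦ s' ⌢X⌢ A' ⟧ X → ⟦ A ⟧ X ≈ ⟦ A' ⟧ X
  cancel s≈s' X eq = ⌢-cancelˡ X (⟦ A ⟧ X) (⟦ A' ⟧ X)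
    (⌢-cancelˡ s _ _ (≈-trans eq (⌢-congʳ (X ⌢ˢ ⟦ A' ⟧ X) (≈-sym s≈s'))))

ConstantAbove : ℕ → Env → QFFormula → Set
ConstantAbove B ρ φ =
  ∀ X Y → HeadAtLeast B X → HeadAtLeast B Y → Sat (setX ρ X) φ → Sat (setX ρ Y) φ

ConstantAbove-mono : ∀ {B B' ρ φ} → B ≤ B' → ConstantAbove B ρ φ → ConstantAbove B' ρ φ
ConstantAbove-mono B≤B' φ-const X Y (0≺X , B'≤X) (0≺Y , B'≤Y) =
  φ-const X Y (0≺X , ≤-trans B≤B' B'≤X) (0≺Y , ≤-trans B≤B' B'≤Y)

jointly-constant : ∀ {ρ φ ψ} → ¬ ¬ (∃[ B ] ConstantAbove B ρ φ) → ¬ ¬ (∃[ B ] ConstantAbove B ρ ψ) →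
                   ¬ ¬ (∃[ B ] (ConstantAbove B ρ φ × ConstantAbove B ρ ψ))
jointly-constant ¬¬φ ¬¬ψ = do
  (B₁ , φ-const) ← ¬¬φ
  (B₂ , ψ-const) ← ¬¬ψ
  pure (B₁ ⊔ B₂ , ConstantAbove-mono (m≤m⊔n B₁ B₂) φ-const , ConstantAbove-mono (m≤n⊔m B₁ B₂) ψ-const)

eventually-constant : ∀ ρ φ → ¬ ¬ (∃[ B ] ConstantAbove B ρ φ)
eventually-constant ρ (eqI (ivar i) (ivar j)) = pure (0 , λ _ _ _ _ i≡j → i≡j)
eventually-constant ρ (eqL S T) = do
  inj₁ S≈T ← decide-shapes (shape ρ S) (shape ρ T)
    where inj₂ (B , S≉T) → pure (B , λ X Y X≥ _ S≈T → contradiction (via-shapes X S≈T) (S≉T X X≥))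
  pure (0 , λ _ Y _ _ _ → ≈-trans (shape-sound ρ S Y) (≈-trans (S≈T Y) (≈-sym (shape-sound ρ T Y))))
  where
  via-shapes : ∀ X → evalL (setX ρ X) S ≈ evalL (setX ρ X) T → ⟦ shape ρ S ⟧ X ≈ ⟦ shape ρ T ⟧ X
  via-shapes X S≈T = ≈-trans (≈-sym (shape-sound ρ S X)) (≈-trans S≈T (shape-sound ρ T X))
eventually-constant ρ falseF = pure (0 , λ _ _ _ _ ())
eventually-constant ρ (notF φ) = do
  (B , φ-const) ← eventually-constant ρ φ
  pure (B , λ X Y X≥ Y≥ ¬φ φ' → ¬φ (φ-const Y X Y≥ X≥ φ'))
eventually-constant ρ (andF φ ψ) = do
  (B , φ-const , ψ-const) ← jointly-constant (eventually-constant ρ φ) (eventually-constant ρ ψ)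
  pure (B , λ X Y X≥ Y≥ (φ' , ψ') → φ-const X Y X≥ Y≥ φ' , ψ-const X Y X≥ Y≥ ψ')
eventually-constant ρ (orF φ ψ) = do
  (B , φ-const , ψ-const) ← jointly-constant (eventually-constant ρ φ) (eventually-constant ρ ψ)
  pure (B , λ X Y X≥ Y≥ φ∨ψ (¬φ , ¬ψ) →
    φ∨ψ ((λ φ' → ¬φ (φ-const X Y X≥ Y≥ φ')) , (λ ψ' → ¬ψ (ψ-const X Y X≥ Y≥ ψ'))))
eventually-constant ρ (impF φ ψ) = do
  (B , φ-const , ψ-const) ← jointly-constant (eventually-constant ρ φ) (eventually-constant ρ ψ)
  pure (B , λ X Y X≥ Y≥ φ⇒ψ φ' → ψ-const X Y X≥ Y≥ (φ⇒ψ (φ-const Y X Y≥ X≥ φ')))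

-- Finite and infinite elements of 𝔏

chunk-induction : ∀ {A : Set} {P : List A → Set} k →
                  (∀ xs → length xs < suc k → P xs) →
                  (∀ xs ys → length xs ≡ suc k → P ys → P (xs ++ ys)) →
                  ∀ xs → P xs
chunk-induction {P = P} k short chunk xs = go (length xs) xs ≤-refl
  where
  go : ∀ n xs → length xs ≤ n → P xs
  go n xs _ with length xs <? suc k
  ... | yes xs<k = short xs xs<k
  go zero xs xs≤0 | no xs≮k = contradiction (s≤s (≤-trans xs≤0 z≤n)) xs≮k
  go (suc n) xs xs≤n | no xs≮k =
    subst P (take++drop≡id (suc k) xs) (chunk (take (suc k) xs) (drop (suc k) xs) take≡ (go n (drop (suc k) xs) drop≤))
    where
    take≡ : length (take (suc k) xs) ≡ suc k
    take≡ = trans (length-take (suc k) xs) (m≤n⇒m⊓n≡m (≮⇒≥ xs≮k))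
    drop≤ : length (drop (suc k) xs) ≤ n
    drop≤ = ≤-trans (≤-reflexive (length-drop (suc k) xs)) (≤-trans (∸-monoˡ-≤ (suc k) xs≤n) (m∸n≤m n k))

consList-++ : ∀ xs ys l → consList (xs ++ ys) l ≡ consList xs (consList ys l)
consList-++ [] ys l = refl
consList-++ (x ∷ xs) ys l = cong (consˢ x) (consList-++ xs ys l)

len-consList-εˢ : ∀ xs → len (consList xs εˢ) ≡ ⟨ 0 , 0 , length xs ⟩
len-consList-εˢ [] = refl
len-consList-εˢ (x ∷ xs) rewrite len-consList-εˢ xs = refl

In𝔏-finite : ∀ {S n} → len S ≡ ⟨ 0 , 0 , n ⟩ → In𝔏 S
In𝔏-finite S≡n p q block rewrite S≡n with block
... | inj₁ ()
... | inj₂ (_ , ())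

-- Exactly the condition under which In𝔏 constrains the first ω-block.
Infinite : Ord3 → Set
Infinite α = 0 < p α ⊎ (0 ≡ p α × 0 < q α)

finite-or-infinite : ∀ α → (∃[ n ] α ≡ ⟨ 0 , 0 , n ⟩) ⊎ Infinite α
finite-or-infinite ⟨ zero , zero , n ⟩ = inj₁ (n , refl)
finite-or-infinite ⟨ zero , suc q , r ⟩ = inj₂ (inj₂ (refl , z<s))
finite-or-infinite ⟨ suc p , q , r ⟩ = inj₂ (inj₁ z<s)

Infinite⇒0ᴼ≺ : ∀ {α} → Infinite α → 0ᴼ ≺ α
Infinite⇒0ᴼ≺ (inj₁ 0<p) = inj₁ 0<p
Infinite⇒0ᴼ≺ (inj₂ (0≡p , 0<q)) = inj₂ (0≡p , inj₁ 0<q)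

Infinite⇒∸ᴼ1ᴼ : ∀ {α} → Infinite α → α ∸ᴼ 1ᴼ ≡ α
Infinite⇒∸ᴼ1ᴼ {⟨ suc p , q , r ⟩} _ = refl
Infinite⇒∸ᴼ1ᴼ {⟨ zero , suc q , r ⟩} _ = refl
Infinite⇒∸ᴼ1ᴼ {⟨ zero , zero , r ⟩} (inj₂ (_ , ()))

tail : Seq → Seq
tail S = mkSeq (len S ∸ᴼ 1ᴼ) (λ i → val S (1ᴼ +ᴼ i))

cons-head-tail : ∀ S → 0ᴼ ≺ len S → consˢ (val S 0ᴼ) (tail S) ≈ S
cons-head-tail S 0≺S with ≺⊎≡+ᴼ 1ᴼ (len S)
... | inj₁ S≺1 = contradiction (subst (0ᴼ ≺_) (≺1ᴼ⇒≡0ᴼ S≺1) 0≺S) ≺-irrefl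
... | inj₂ (δ , S≡1+δ) = ≈-intro lens vals
  where
  lens : 1ᴼ +ᴼ (len S ∸ᴼ 1ᴼ) ≡ len S
  lens = begin
    1ᴼ +ᴼ (len S ∸ᴼ 1ᴼ)           ≡⟨ cong (λ α → 1ᴼ +ᴼ (α ∸ᴼ 1ᴼ)) S≡1+δ ⟩
    1ᴼ +ᴼ ((1ᴼ +ᴼ δ) ∸ᴼ 1ᴼ)       ≡⟨ cong (1ᴼ +ᴼ_) (+ᴼ-∸ᴼ 1ᴼ δ) ⟩
    1ᴼ +ᴼ δ                       ≡⟨ S≡1+δ ⟨
    len S                         ∎
    where open ≡-Reasoning
  vals : ∀ i → i ≺ 1ᴼ +ᴼ (len S ∸ᴼ 1ᴼ) → val (consˢ (val S 0ᴼ) (tail S)) i ≡ val S i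
  vals i _ with ≺⊎≡+ᴼ 1ᴼ i
  ... | inj₁ i≺1 rewrite ≺1ᴼ⇒≡0ᴼ i≺1 = refl
  ... | inj₂ (ε , refl) = ⌢-val-+ (single (val S 0ᴼ)) (tail S) ε

Infinite-tail : ∀ S → Infinite (len S) → Infinite (len (tail S))
Infinite-tail S S-inf = subst Infinite (sym (Infinite⇒∸ᴼ1ᴼ S-inf)) S-inf

In𝒩-shift : ∀ {f} → In𝒩 f → In𝒩 (λ r → f (suc r))
In𝒩-shift ([] , k , f≡) = [] , suc k , λ r → trans (f≡ (suc r)) (+-suc k r)
In𝒩-shift ((_ ∷ w) , k , f≡) = w , k , λ r → f≡ (suc r)

In𝔏-tail : ∀ S → Infinite (len S) → In𝔏 S → In𝔏 (tail S)
In𝔏-tail S S-inf S∈𝔏 p q block =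
  shifted p q (subst (λ α → p < Ord3.p α ⊎ (p ≡ Ord3.p α × q < Ord3.q α)) (Infinite⇒∸ᴼ1ᴼ S-inf) block)
  where
  shifted : ∀ p q → p < Ord3.p (len S) ⊎ (p ≡ Ord3.p (len S) × q < Ord3.q (len S)) →
            In𝒩 (λ r → val (tail S) ⟨ p , q , r ⟩)
  shifted zero zero _ = In𝒩-shift (S∈𝔏 0 0 S-inf)
  shifted zero (suc q) block = S∈𝔏 0 (suc q) block
  shifted (suc p) q block = S∈𝔏 (suc p) q block

takeˢ : ℕ → Seq → List ℕ
takeˢ zero S = []
takeˢ (suc k) S = val S 0ᴼ ∷ takeˢ k (tail S)

dropˢ : ℕ → Seq → Seq
dropˢ zero S = S
dropˢ (suc k) S = dropˢ k (tail S)

length-takeˢ : ∀ k S → length (takeˢ k S) ≡ k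
length-takeˢ zero S = refl
length-takeˢ (suc k) S = cong suc (length-takeˢ k (tail S))

dropˢ-+ : ∀ a b S → dropˢ (a + b) S ≡ dropˢ b (dropˢ a S)
dropˢ-+ zero b S = refl
dropˢ-+ (suc a) b S = dropˢ-+ a b (tail S)

val-dropˢ : ∀ d S r → val (dropˢ d S) ⟨ 0 , 0 , r ⟩ ≡ val S ⟨ 0 , 0 , d + r ⟩
val-dropˢ zero S r = refl
val-dropˢ (suc d) S r = val-dropˢ d (tail S) r

Infinite-dropˢ : ∀ k S → Infinite (len S) → Infinite (len (dropˢ k S))
Infinite-dropˢ zero S S-inf = S-inf
Infinite-dropˢ (suc k) S S-inf = Infinite-dropˢ k (tail S) (Infinite-tail S S-inf)

In𝔏-dropˢ : ∀ k S → Infinite (len S) → In𝔏 S → In𝔏 (dropˢ k S)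
In𝔏-dropˢ zero S S-inf S∈𝔏 = S∈𝔏
In𝔏-dropˢ (suc k) S S-inf S∈𝔏 = In𝔏-dropˢ k (tail S) (Infinite-tail S S-inf) (In𝔏-tail S S-inf S∈𝔏)

takeˢ-dropˢ : ∀ k S → Infinite (len S) → consList (takeˢ k S) (dropˢ k S) ≈ S
takeˢ-dropˢ zero S S-inf = ≈-refl
takeˢ-dropˢ (suc k) S S-inf =
  ≈-trans (⌢-congˡ (single (val S 0ᴼ)) (takeˢ-dropˢ k (tail S) (Infinite-tail S S-inf)))
          (cons-head-tail S (Infinite⇒0ᴼ≺ S-inf))

takeˢ-finite : ∀ n S → len S ≡ ⟨ 0 , 0 , n ⟩ → consList (takeˢ n S) εˢ ≈ S
takeˢ-finite zero S S≡0 = ≈-intro (sym S≡0) λ i i≺0 → contradiction i≺0 ⊀0ᴼ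
takeˢ-finite (suc n) S S≡n =
  ≈-trans (⌢-congˡ (single (val S 0ᴼ)) (takeˢ-finite n (tail S) (cong (_∸ᴼ 1ᴼ) S≡n)))
          (cons-head-tail S (subst (0ᴼ ≺_) (sym S≡n) (inj₂ (refl , inj₂ (refl , z<s)))))

wN-≥ : ∀ w k d → d ≤ wN w k d + length w
wN-≥ [] k d = ≤-trans (m≤n+m d k) (≤-reflexive (sym (+-identityʳ (k + d))))
wN-≥ (x ∷ w) k zero = z≤n
wN-≥ (x ∷ w) k (suc d) = ≤-trans (s≤s (wN-≥ w k d)) (≤-reflexive (sym (+-suc (wN w k d) (length w))))

first-block-unbounded : ∀ S → Infinite (len S) → In𝔏 S →
                        ∀ B → ∃[ N ] (∀ d → N ≤ d → B ≤ val S ⟨ 0 , 0 , d ⟩)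
first-block-unbounded S S-inf S∈𝔏 B with S∈𝔏 0 0 S-inf
... | w , k , S≡wN = B + length w , λ d N≤d →
  subst (B ≤_) (sym (S≡wN d)) (+-cancelʳ-≤ (length w) B _ (≤-trans N≤d (wN-≥ w k d)))

suffix-head-unbounded : ∀ S → Infinite (len S) → In𝔏 S →
                        ∀ k B → ∃[ N ] HeadAtLeast B (dropˢ (N * suc k) S)
suffix-head-unbounded S S-inf S∈𝔏 k B with first-block-unbounded S S-inf S∈𝔏 B
... | N , unbounded = N , Infinite⇒0ᴼ≺ (Infinite-dropˢ d S S-inf) ,
  subst (B ≤_) (sym (val-dropˢ d S 0)) (unbounded (d + 0) (≤-trans (m≤m*n N (suc k)) (m≤m+n d 0)))
  where d = N * suc k

-- m-step induction in M₂

module _ (m : ℕ) (φ : QFFormula) (ρ : Env)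
  (base : (xs : List ℕ) → length xs < suc m → Sat (setX ρ (consList xs εˢ)) φ)
  (step : (L : Seq) → In𝔏 L → (xs : List ℕ) → length xs ≡ suc m →
          Sat (setX ρ L) φ → Sat (setX ρ (consList xs L)) φ)
  where

  finite-sat : ∀ xs → Sat (setX ρ (consList xs εˢ)) φ
  finite-sat = chunk-induction m base λ xs ys xs≡ ys-sat →
    subst (λ L → Sat (setX ρ L) φ) (sym (consList-++ xs ys εˢ))
      (step (consList ys εˢ) (In𝔏-finite (len-consList-εˢ ys)) xs xs≡ ys-sat)

  descend : ∀ c S → Infinite (len S) → In𝔏 S →
            Sat (setX ρ (dropˢ (c * suc m) S)) φ → Sat (setX ρ S) φ
  descend zero S _ _ sat = sat
  descend (suc c) S S-inf S∈𝔏 sat =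
    Sat-cong ρ φ (takeˢ-dropˢ (suc m) S S-inf)
      (step S' S'∈𝔏 (takeˢ (suc m) S) (length-takeˢ (suc m) S)
        (descend c S' (Infinite-dropˢ (suc m) S S-inf) S'∈𝔏
          (subst (λ L → Sat (setX ρ L) φ) (dropˢ-+ (suc m) (c * suc m) S) sat)))
    where
    S' = dropˢ (suc m) S
    S'∈𝔏 = In𝔏-dropˢ (suc m) S S-inf S∈𝔏

  infinite-sat : ∀ L → Infinite (len L) → In𝔏 L → ¬ ¬ Sat (setX ρ L) φ
  infinite-sat L L-inf L∈𝔏 = do
    (B , φ-const) ← eventually-constant ρ φ
    let (N , T-large) = suffix-head-unbounded L L-inf L∈𝔏 m B
        j = val (dropˢ (N * suc m) L) 0ᴼ
        [j]-large : HeadAtLeast B (consList (j ∷ []) εˢ)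
        [j]-large = inj₂ (refl , inj₂ (refl , z<s)) , proj₂ T-large
    pure (descend N L L-inf L∈𝔏 (φ-const _ _ [j]-large T-large (finite-sat (j ∷ []))))

proposition4p15 : (m : ℕ) → m ≥ 1 → (φ : QFFormula) → M₂⊨Ind m φ
proposition4p15 zero () φ
proposition4p15 (suc m) _ φ ρ _ base step L L∈𝔏 with finite-or-infinite (len L)
... | inj₁ (n , L≡n) = Sat-cong ρ φ (takeˢ-finite n L L≡n) (finite-sat m φ ρ base step (takeˢ n L))
... | inj₂ L-inf = Sat-stable (setX ρ L) φ (infinite-sat m φ ρ base step L L-inf L∈𝔏)
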